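{- Let $\varOmega$ be a set and $\mathcal{Q}=\{\mathcal{P}_x:x\in Q\}$ a family of partitions of $\varOmega$ closed under join. Let $x,y,z\in Q$ satisfy $\mathcal{P}_{x\vee z}\perp\mathcal{P}_{y\vee z}\mid\mathcal{P}_z$. Then for every $S\in P_Q(\varOmega)$, $$\sigma_{y\vee z}(\sigma_x(S))=\sigma_{y\vee z}(\sigma_z(\sigma_x(S))).$$
   Context: For partitions $\mathcal{P},\mathcal{P}'$ of $\varOmega$, $\mathcal{P}\le\mathcal{P}'$ iff every block of $\mathcal{P}'$ is contained in a block of $\mathcal{P}$; the join $\mathcal{P}\vee\mathcal{P}'$ is the partition into nonempty intersections of blocks of $\mathcal{P}$ with blocks of $\mathcal{P}'$, and $\mathcal{P}_{x\vee y}:=\mathcal{P}_x\vee\mathcal{P}_y$. Write $\omega\equiv_x\omega'$ if $\omega,\omega'$ lie in the same block of $\mathcal{P}_x$. The saturation operator is $\sigma_x(S):=\{\omega\in\varOmega:\exists\omega'\in S,\ \omega\equiv_x\omega'\}$ for $S\subseteq\varOmega$. $P_Q(\varOmega)$ is the family of subsets $S\subseteq\varOmega$ with $\sigma_x(S)=S$ for some $x\in Q$. Conditional independence: $\mathcal{P}_1\perp\mathcal{P}_2\mid\mathcal{P}$ iff for every block $B$ of $\mathcal{P}$ and blocks $B_1\in\mathcal{P}_1$, $B_2\in\mathcal{P}_2$ with $B_1\cap B\neq\emptyset$ and $B_2\cap B\ne\emptyset$, one has $B_1\cap B_2\cap B\ne\emptyset$. -}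

module Defs where

open import Data.Product using (Σ; ∃; _×_; _,_)
open import Relation.Binary.Core using (Rel)
open import Relation.Binary.Structures using (IsEquivalence)
open import Relation.Unary using (Pred)
open import Level using (0ℓ)

-- A partition of Ω, represented by its equivalence relation
-- (ω ≈ ω' iff ω and ω' lie in the same block).
record Partition (Ω : Set) : Set₁ where
  field
    _≈_           : Rel Ω 0ℓ
    isEquivalence : IsEquivalence _≈_

open Partition public

_∋_≡ₚ_ : {Ω : Set} → Partition Ω → Ω → Ω → Set
𝒫 ∋ a ≡ₚ b = Partition._≈_ 𝒫 a b

-- Join: blocks are the nonempty intersections of blocks,
-- i.e. same block in the join iff same block in both.
_∨ₚ_ : {Ω : Set} → Partition Ω → Partition Ω → Partition Ω
_∨ₚ_ {Ω} 𝒫 𝒫' = record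
  { _≈_ = λ a b → (𝒫 ∋ a ≡ₚ b) × (𝒫' ∋ a ≡ₚ b)
  ; isEquivalence = record
      { refl  = IsEquivalence.refl (isEquivalence 𝒫) , IsEquivalence.refl (isEquivalence 𝒫')
      ; sym   = λ { (p , q) → IsEquivalence.sym (isEquivalence 𝒫) p , IsEquivalence.sym (isEquivalence 𝒫') q }
      ; trans = λ { (p , q) (p' , q') → IsEquivalence.trans (isEquivalence 𝒫) p p'
                                       , IsEquivalence.trans (isEquivalence 𝒫') q q' }
      }
  }

_≐ₚ_ : {Ω : Set} → Partition Ω → Partition Ω → Set
_≐ₚ_ {Ω} 𝒫 𝒫' = ∀ (a b : Ω) → ((𝒫 ∋ a ≡ₚ b) → (𝒫' ∋ a ≡ₚ b)) × ((𝒫' ∋ a ≡ₚ b) → (𝒫 ∋ a ≡ₚ b))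

_≐_ : {Ω : Set} → Pred Ω 0ℓ → Pred Ω 0ℓ → Set
_≐_ {Ω} S T = ∀ (ω : Ω) → (S ω → T ω) × (T ω → S ω)

σ : {Ω : Set} → Partition Ω → Pred Ω 0ℓ → Pred Ω 0ℓ
σ {Ω} 𝒫 S ω = Σ Ω (λ ω' → S ω' × (𝒫 ∋ ω ≡ₚ ω'))

ClosedUnderJoin : {Ω Q : Set} → (Q → Partition Ω) → Set
ClosedUnderJoin {Ω} {Q} 𝒫 = ∀ (x y : Q) → Σ Q (λ w → 𝒫 w ≐ₚ (𝒫 x ∨ₚ 𝒫 y))

InPQ : {Ω Q : Set} → (Q → Partition Ω) → Pred Ω 0ℓ → Set
InPQ {Ω} {Q} 𝒫 S = Σ Q (λ x → σ (𝒫 x) S ≐ S)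

-- 𝒫₁ ⊥ 𝒫₂ | 𝒫 : for every block B of 𝒫 (represented by ω) and blocks
-- B₁ ∋ ω₁, B₂ ∋ ω₂ meeting B (ω₁, ω₂ ∈ B), B₁ ∩ B₂ ∩ B ≠ ∅.
CondIndep : {Ω : Set} → Partition Ω → Partition Ω → Partition Ω → Set
CondIndep {Ω} 𝒫₁ 𝒫₂ 𝒫 =
  ∀ (ω ω₁ ω₂ : Ω) → (𝒫 ∋ ω₁ ≡ₚ ω) → (𝒫 ∋ ω₂ ≡ₚ ω) →
    Σ Ω (λ c → (𝒫₁ ∋ c ≡ₚ ω₁) × (𝒫₂ ∋ c ≡ₚ ω₂) × (𝒫 ∋ c ≡ₚ ω))

-- Conditional independence lets us replace a detour through a 𝒫_z-block by a
-- single point: if b ≡_{y∨z} ω and b ≡_z a with a ∈ σ_x(S), the blocks of a in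
-- 𝒫_{x∨z} and of b in 𝒫_{y∨z} both meet the 𝒫_z-block of b, hence meet each
-- other in some c; then c ∈ σ_x(S) and c ≡_{y∨z} ω.
module Submission where

open import Defs
open import Data.Product using (_,_; proj₁)
open import Level using (0ℓ)
open import Relation.Binary.Structures using (IsEquivalence)
open import Relation.Unary using (Pred; _⊆_)

module _ {Ω : Set} where

  private
    module Eq (𝒫 : Partition Ω) = IsEquivalence (isEquivalence 𝒫)

  Saturated : Partition Ω → Pred Ω 0ℓ → Set
  Saturated 𝒫 T = σ 𝒫 T ⊆ T

  σ-inflationary : (𝒫 : Partition Ω) (S : Pred Ω 0ℓ) → S ⊆ σ 𝒫 S
  σ-inflationary 𝒫 S {ω} ωS = ω , ωS , Eq.refl 𝒫

  σ-monotone : (𝒫 : Partition Ω) {S T : Pred Ω 0ℓ} → S ⊆ T → σ 𝒫 S ⊆ σ 𝒫 T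
  σ-monotone 𝒫 S⊆T (ω' , ω'S , ωω') = ω' , S⊆T ω'S , ωω'

  σ-saturated : (𝒫 : Partition Ω) (S : Pred Ω 0ℓ) → Saturated 𝒫 (σ 𝒫 S)
  σ-saturated 𝒫 S (ω' , (ω'' , ω''S , ω'ω'') , ωω') =
    ω'' , ω''S , Eq.trans 𝒫 ωω' ω'ω''

  saturated-∨ˡ : (𝒫 𝒫' : Partition Ω) {T : Pred Ω 0ℓ} →
    Saturated 𝒫 T → Saturated (𝒫 ∨ₚ 𝒫') T
  saturated-∨ˡ 𝒫 𝒫' sat (ω' , ω'T , ωω') = sat (ω' , ω'T , proj₁ ωω')

  condIndep⇒σ-absorbs : (𝒫₁ 𝒫₂ 𝒫 : Partition Ω) → CondIndep 𝒫₁ 𝒫₂ 𝒫 →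
    {T : Pred Ω 0ℓ} → Saturated 𝒫₁ T → σ 𝒫₂ (σ 𝒫 T) ⊆ σ 𝒫₂ T
  condIndep⇒σ-absorbs 𝒫₁ 𝒫₂ 𝒫 ci sat (b , (a , aT , ba) , ωb)
    with ci b a b (Eq.sym 𝒫 ba) (Eq.refl 𝒫)
  ... | c , ca , cb , _ = c , sat (a , aT , ca) , Eq.trans 𝒫₂ ωb (Eq.sym 𝒫₂ cb)

theorem3 : (Ω Q : Set) (𝒫 : Q → Partition Ω) → ClosedUnderJoin 𝒫 →
    (x y z : Q) → CondIndep (𝒫 x ∨ₚ 𝒫 z) (𝒫 y ∨ₚ 𝒫 z) (𝒫 z) →
    (S : Pred Ω 0ℓ) → InPQ 𝒫 S →
    σ (𝒫 y ∨ₚ 𝒫 z) (σ (𝒫 x) S) ≐ σ (𝒫 y ∨ₚ 𝒫 z) (σ (𝒫 z) (σ (𝒫 x) S))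
theorem3 Ω Q 𝒫 _ x y z ci S _ ω =
    σ-monotone (𝒫 y ∨ₚ 𝒫 z) (σ-inflationary (𝒫 z) (σ (𝒫 x) S))
  , condIndep⇒σ-absorbs (𝒫 x ∨ₚ 𝒫 z) (𝒫 y ∨ₚ 𝒫 z) (𝒫 z) ci
      (saturated-∨ˡ (𝒫 x) (𝒫 z) (σ-saturated (𝒫 x) S))
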